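{- If $G$ is a generalized geodetic graph, then $\mathrm{sg}(G\,\square\, H)\ge \mathrm{sg}(G)$ holds for every graph $H$.
   Context: Graphs are finite and simple; strong geodetic notions are considered for connected graphs. $G\,\square\,H$ is the Cartesian product: vertex set $V(G)\times V(H)$, with $(g,h)\sim(g',h')$ iff either $g=g'$ and $hh'\in E(H)$, or $h=h'$ and $gg'\in E(G)$. For $S\subseteq V(G)$, $S$ is a strong geodetic set if one can fix, for each unordered pair of distinct $x,y\in S$, a single shortest $x,y$-path so that the union of the vertex sets of the chosen paths is $V(G)$; $\mathrm{sg}(G)$ is the minimum size of a strong geodetic set. The interval $I_G(u,v)$ is the set of vertices lying on some shortest $u,v$-path; the geodetic number $\mathrm{g}(G)$ is the minimum size of $S\subseteq V(G)$ with $\bigcup_{\{u,v\}\subseteq S} I_G(u,v)=V(G)$. A graph $G$ is generalized geodetic if $\mathrm{g}(G)=\mathrm{sg}(G)$. -}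

module Defs where

open import Data.Nat using (ℕ; zero; suc; _≤_; _*_)
open import Data.Bool using (Bool; true; false; _∧_; _∨_)
open import Data.Fin as Fin using (Fin; remQuot)
open import Data.Fin.Subset using (Subset; _∈_; ∣_∣)
open import Data.Product using (Σ; ∃; _×_; _,_; proj₁; proj₂)
open import Data.Sum using (_⊎_)
open import Relation.Nullary using (¬_)
open import Relation.Nullary.Decidable using (⌊_⌋)
open import Relation.Binary.PropositionalEquality using (_≡_)

record Graph : Set where
  constructor graph
  field
    n   : ℕ
    adj : Fin n → Fin n → Bool

V : Graph → Set
V G = Fin (Graph.n G)

Adj : (G : Graph) → V G → V G → Set
Adj G u v = Graph.adj G u v ≡ true

Simple : Graph → Set
Simple G = (∀ u v → Adj G u v → Adj G v u) × (∀ u → ¬ Adj G u u)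

data Walk (G : Graph) : V G → V G → ℕ → Set where
  nil  : ∀ {u} → Walk G u u 0
  cons : ∀ {u w v k} → Adj G u w → Walk G w v k → Walk G u v (suc k)

OnWalk : {G : Graph} {u v : V G} {k : ℕ} → V G → Walk G u v k → Set
OnWalk {u = u} x nil        = x ≡ u
OnWalk {u = u} x (cons _ p) = x ≡ u ⊎ OnWalk x p

Connected : Graph → Set
Connected G = 1 ≤ Graph.n G × (∀ u v → ∃ λ k → Walk G u v k)

record Geodesic (G : Graph) (u v : V G) : Set where
  field
    len      : ℕ
    walk     : Walk G u v len
    shortest : ∀ m → Walk G u v m → len ≤ m

OnGeodesic : {G : Graph} {u v : V G} → V G → Geodesic G u v → Set
OnGeodesic x P = OnWalk x (Geodesic.walk P)

InInterval : (G : Graph) → V G → V G → V G → Set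
InInterval G u v x = Σ (Geodesic G u v) λ P → OnGeodesic x P

-- geodetic set: every vertex lies in I(u,v) for some u,v ∈ S
-- (vertices of S count as covered, I(u,u) = {u})
IsGeodeticSet : (G : Graph) → Subset (Graph.n G) → Set
IsGeodeticSet G S = ∀ w → w ∈ S ⊎
  (Σ (V G) λ x → Σ (V G) λ y → x ∈ S × y ∈ S × InInterval G x y w)

-- strong geodetic set: one fixed geodesic per unordered pair {x,y} (x < y)
-- of distinct vertices of S, together covering V(G)
IsStrongGeodeticSet : (G : Graph) → Subset (Graph.n G) → Set
IsStrongGeodeticSet G S =
  Σ ((x y : V G) → x ∈ S → y ∈ S → x Fin.< y → Geodesic G x y) λ P →
    ∀ w → w ∈ S ⊎
      (Σ (V G) λ x → Σ (V G) λ y → Σ (x ∈ S) λ xS → Σ (y ∈ S) λ yS →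
         Σ (x Fin.< y) λ lt → OnGeodesic w (P x y xS yS lt))

IsMinimum : {n : ℕ} → (Subset n → Set) → ℕ → Set
IsMinimum P k = (∃ λ S → P S × ∣ S ∣ ≡ k) × (∀ S → P S → k ≤ ∣ S ∣)

GeodeticNumberIs : Graph → ℕ → Set
GeodeticNumberIs G k = IsMinimum (IsGeodeticSet G) k

StrongGeodeticNumberIs : Graph → ℕ → Set
StrongGeodeticNumberIs G k = IsMinimum (IsStrongGeodeticSet G) k

GeneralizedGeodetic : Graph → Set
GeneralizedGeodetic G = ∃ λ k → GeodeticNumberIs G k × StrongGeodeticNumberIs G k

-- Cartesian product; vertex (g,h) encoded via Fin.combine g h (decoded by remQuot)
_□_ : Graph → Graph → Graph
G □ H = graph (Graph.n G * Graph.n H) adj□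
  where
  adj□ : Fin (Graph.n G * Graph.n H) → Fin (Graph.n G * Graph.n H) → Bool
  adj□ i j with remQuot (Graph.n H) i | remQuot (Graph.n H) j
  ... | (g , h) | (g' , h') =
    (⌊ g Fin.≟ g' ⌋ ∧ Graph.adj H h h') ∨ (⌊ h Fin.≟ h' ⌋ ∧ Graph.adj G g g')

module Submission where

-- Let S be a strong geodetic set of G □ H of size b.  Every shortest path
-- of G □ H splits its edges into G-edges and H-edges; the G-edges form a
-- walk of G between the G-coordinates of the end vertices, and this walk is
-- itself a shortest path, since a shorter one could be recombined with the
-- H-edges into a shorter path of G □ H.  Hence the fixed geodesics of S,
-- projected to G, cover the layer G × {h₀}: the projection π_G(S) is a
-- geodetic set of G, of size at most b.  So g(G) ≤ b, and a = sg(G) = g(G)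
-- because G is generalized geodetic.

open import Defs
open import Data.Nat using (ℕ; zero; suc; _+_; _≤_; s≤s)
open import Data.Nat.Properties using (≤-refl; ≤-trans; ≤-reflexive; n≤1+n; +-suc; +-cancelʳ-≤; module ≤-Reasoning)
open import Data.Bool using (Bool; true; false; _∧_; _∨_)
open import Data.Fin using (Fin; combine; quotient; remainder; fromℕ<; _≟_)
open import Data.Fin.Properties using (remQuot-combine; combine-remQuot)
open import Data.Fin.Subset using (Subset; _∈_; ∣_∣; ⊥; inside; outside)
open import Data.Fin.Subset.Properties using (∣⊥∣≡0)
open import Data.Vec using (_∷_; []; here; there)
open import Data.Product using (Σ; _×_; _,_; proj₁; proj₂)
open import Data.Sum using (_⊎_; inj₁; inj₂)
open import Function using (_∘_)
open import Relation.Nullary using (Dec; yes; no)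
open import Relation.Nullary.Decidable using (isYes)
open import Relation.Binary.PropositionalEquality
  using (_≡_; refl; sym; trans; cong; subst; subst₂)

insert : ∀ {n} → Fin n → Subset n → Subset n
insert Fin.zero    (_ ∷ q) = inside ∷ q
insert (Fin.suc x) (b ∷ q) = b ∷ insert x q

∣insert∣≤ : ∀ {n} (x : Fin n) (q : Subset n) → ∣ insert x q ∣ ≤ suc ∣ q ∣
∣insert∣≤ Fin.zero    (inside  ∷ q) = n≤1+n _
∣insert∣≤ Fin.zero    (outside ∷ q) = ≤-refl
∣insert∣≤ (Fin.suc x) (inside  ∷ q) = s≤s (∣insert∣≤ x q)
∣insert∣≤ (Fin.suc x) (outside ∷ q) = ∣insert∣≤ x q

x∈insert : ∀ {n} (x : Fin n) (q : Subset n) → x ∈ insert x q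
x∈insert Fin.zero    (_ ∷ q) = here
x∈insert (Fin.suc x) (_ ∷ q) = there (x∈insert x q)

∈insert : ∀ {n} (x : Fin n) (q : Subset n) {y : Fin n} → y ∈ q → y ∈ insert x q
∈insert Fin.zero    (_ ∷ q) here      = here
∈insert Fin.zero    (_ ∷ q) (there p) = there p
∈insert (Fin.suc x) (_ ∷ q) here      = here
∈insert (Fin.suc x) (_ ∷ q) (there p) = there (∈insert x q p)

image : ∀ {N n} → (Fin N → Fin n) → Subset N → Subset n
image {zero}  f []            = ⊥
image {suc N} f (inside  ∷ s) = insert (f Fin.zero) (image (f ∘ Fin.suc) s)
image {suc N} f (outside ∷ s) = image (f ∘ Fin.suc) s

∣image∣≤ : ∀ {N n} (f : Fin N → Fin n) (s : Subset N) → ∣ image f s ∣ ≤ ∣ s ∣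
∣image∣≤ {zero} {n} f []      = ≤-reflexive (∣⊥∣≡0 n)
∣image∣≤ {suc N} f (inside ∷ s) =
  ≤-trans (∣insert∣≤ (f Fin.zero) _) (s≤s (∣image∣≤ (f ∘ Fin.suc) s))
∣image∣≤ {suc N} f (outside ∷ s) = ∣image∣≤ (f ∘ Fin.suc) s

∈image : ∀ {N n} (f : Fin N → Fin n) (s : Subset N) {i : Fin N} → i ∈ s → f i ∈ image f s
∈image f (inside  ∷ s) here      = x∈insert (f Fin.zero) _
∈image f (inside  ∷ s) (there p) = ∈insert (f Fin.zero) _ (∈image (f ∘ Fin.suc) s p)
∈image f (outside ∷ s) (there p) = ∈image (f ∘ Fin.suc) s p

∧∨∧-elim : ∀ {a b c d : Bool} → (a ∧ b) ∨ (c ∧ d) ≡ true →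
  (a ≡ true × b ≡ true) ⊎ (c ≡ true × d ≡ true)
∧∨∧-elim {true} {true}                   _ = inj₁ (refl , refl)
∧∨∧-elim {true} {false} {true} {true}    _ = inj₂ (refl , refl)
∧∨∧-elim {false}        {c = true} {true} _ = inj₂ (refl , refl)

∧∨∧-introˡ : ∀ (a b c d : Bool) → a ≡ true → b ≡ true → (a ∧ b) ∨ (c ∧ d) ≡ true
∧∨∧-introˡ _ _ _ _ refl refl = refl

∧∨∧-introʳ : ∀ (a b c d : Bool) → c ≡ true → d ≡ true → (a ∧ b) ∨ (c ∧ d) ≡ true
∧∨∧-introʳ true  true  _ _ refl refl = refl
∧∨∧-introʳ true  false _ _ refl refl = refl
∧∨∧-introʳ false _     _ _ refl refl = refl

isYes-sound : ∀ {A : Set} (a? : Dec A) → isYes a? ≡ true → A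
isYes-sound (yes a) _ = a

isYes-complete : ∀ {A : Set} (a? : Dec A) → A → isYes a? ≡ true
isYes-complete (yes _) _ = refl
isYes-complete (no ¬a) a with () ← ¬a a

_++ʷ_ : ∀ {G u v w k m} → Walk G u v k → Walk G v w m → Walk G u w (k + m)
nil      ++ʷ q = q
cons e p ++ʷ q = cons e (p ++ʷ q)

onWalk-start : ∀ {G u v k} (p : Walk G u v k) → OnWalk u p
onWalk-start nil        = refl
onWalk-start (cons _ p) = inj₁ refl

moveStart : ∀ {G u u' v k} → u ≡ u' → Walk G u v k → Walk G u' v k
moveStart {G} {v = v} {k} = subst (λ a → Walk G a v k)

onWalk-moveStart : ∀ {G u u' v k x} (e : u ≡ u') (p : Walk G u v k) →
  OnWalk x p → OnWalk x (moveStart e p)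
onWalk-moveStart refl p o = o

module Product (G H : Graph) where

  P : Graph
  P = G □ H

  πG : V P → V G
  πG = quotient {Graph.n G} (Graph.n H)

  πH : V P → V H
  πH = remainder {Graph.n G} (Graph.n H)

  πG-combine : ∀ (g : V G) (h : V H) → πG (combine g h) ≡ g
  πG-combine g h = cong proj₁ (remQuot-combine g h)

  πH-combine : ∀ (g : V G) (h : V H) → πH (combine g h) ≡ h
  πH-combine g h = cong proj₂ (remQuot-combine g h)

  combine-π : ∀ i → combine (πG i) (πH i) ≡ i
  combine-π = combine-remQuot {Graph.n G} (Graph.n H)

  adj□-elim : ∀ i j → Adj P i j →
    (πG i ≡ πG j × Adj H (πH i) (πH j)) ⊎ (πH i ≡ πH j × Adj G (πG i) (πG j))
  adj□-elim i j e with ∧∨∧-elim e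
  ... | inj₁ (same , eH) = inj₁ (isYes-sound (πG i ≟ πG j) same , eH)
  ... | inj₂ (same , eG) = inj₂ (isYes-sound (πH i ≟ πH j) same , eG)

  adj□-intro : ∀ i j →
    (πG i ≡ πG j × Adj H (πH i) (πH j)) ⊎ (πH i ≡ πH j × Adj G (πG i) (πG j)) →
    Adj P i j
  adj□-intro i j (inj₁ (sameG , eH)) = ∧∨∧-introˡ
    (isYes (πG i ≟ πG j)) (Graph.adj H (πH i) (πH j))
    (isYes (πH i ≟ πH j)) (Graph.adj G (πG i) (πG j))
    (isYes-complete (πG i ≟ πG j) sameG) eH
  adj□-intro i j (inj₂ (sameH , eG)) = ∧∨∧-introʳ
    (isYes (πG i ≟ πG j)) (Graph.adj H (πH i) (πH j))
    (isYes (πH i ≟ πH j)) (Graph.adj G (πG i) (πG j))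
    (isYes-complete (πH i ≟ πH j) sameH) eG

  adj□-G : ∀ {g g'} h → Adj G g g' → Adj P (combine g h) (combine g' h)
  adj□-G {g} {g'} h e = adj□-intro _ _ (inj₂
    ( trans (πH-combine g h) (sym (πH-combine g' h))
    , subst₂ (Adj G) (sym (πG-combine g h)) (sym (πG-combine g' h)) e))

  adj□-H : ∀ g {h h'} → Adj H h h' → Adj P (combine g h) (combine g h')
  adj□-H g {h} {h'} e = adj□-intro _ _ (inj₁
    ( trans (πG-combine g h) (sym (πG-combine g h'))
    , subst₂ (Adj H) (sym (πH-combine g h)) (sym (πH-combine g h')) e))

  liftG : ∀ {g g' k} h → Walk G g g' k → Walk P (combine g h) (combine g' h) k
  liftG h nil        = nil
  liftG h (cons e p) = cons (adj□-G h e) (liftG h p)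

  liftH : ∀ g {h h' k} → Walk H h h' k → Walk P (combine g h) (combine g h') k
  liftH g nil        = nil
  liftH g (cons e p) = cons (adj□-H g e) (liftH g p)

  record Shadow {i j : V P} {L : ℕ} (W : Walk P i j L) : Set where
    field
      lenG   : ℕ
      lenH   : ℕ
      walkG  : Walk G (πG i) (πG j) lenG
      walkH  : Walk H (πH i) (πH j) lenH
      length : lenG + lenH ≡ L
      covers : ∀ x → OnWalk x W → OnWalk (πG x) walkG

  shadow : ∀ {i j L} (W : Walk P i j L) → Shadow W
  shadow nil = record
    { lenG = 0 ; lenH = 0 ; walkG = nil ; walkH = nil ; length = refl
    ; covers = λ { _ refl → refl } }
  shadow {i} (cons {w = k} e W) with shadow W | adj□-elim i k e
  ... | s | inj₁ (sameG , eH) = record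
    { lenG   = lenG
    ; lenH   = suc lenH
    ; walkG  = moveStart (sym sameG) walkG
    ; walkH  = cons eH walkH
    ; length = trans (+-suc lenG lenH) (cong suc length)
    ; covers = λ { _ (inj₁ refl) → onWalk-start (moveStart (sym sameG) walkG)
                 ; x (inj₂ o)    → onWalk-moveStart (sym sameG) walkG (covers x o) } }
    where open Shadow s
  ... | s | inj₂ (sameH , eG) = record
    { lenG   = suc lenG
    ; lenH   = lenH
    ; walkG  = cons eG walkG
    ; walkH  = moveStart (sym sameH) walkH
    ; length = cong suc length
    ; covers = λ { _ (inj₁ refl) → inj₁ refl
                 ; x (inj₂ o)    → inj₂ (covers x o) } }
    where open Shadow s

  -- The G-shadow of a geodesic of G □ H is a geodesic of G: a shorter
  -- G-walk, followed by the H-shadow, would give a shorter walk of G □ H.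
  projectGeodesic : ∀ {i j} (Q : Geodesic P i j) →
    Σ (Geodesic G (πG i) (πG j)) λ R → ∀ x → OnGeodesic x Q → OnGeodesic (πG x) R
  projectGeodesic {i} {j} Q =
    record { len = lenG ; walk = walkG ; shortest = shortest } , covers
    where
    open Shadow (shadow (Geodesic.walk Q))

    recombine : ∀ {m} → Walk G (πG i) (πG j) m → Walk P i j (m + lenH)
    recombine {m} w = subst₂ (λ a b → Walk P a b (m + lenH)) (combine-π i) (combine-π j)
      (liftG (πH i) w ++ʷ liftH (πG j) walkH)

    shortest : ∀ m → Walk G (πG i) (πG j) m → lenG ≤ m
    shortest m w = +-cancelʳ-≤ lenH lenG m
      (subst (_≤ m + lenH) (sym length) (Geodesic.shortest Q (m + lenH) (recombine w)))

  -- If H has a vertex h₀, the G-projection of a strong geodetic set S of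
  -- G □ H is a geodetic set of G: a vertex w of G is covered because (w,h₀)
  -- is covered by S, and projections of geodesics are geodesics.
  projectStrongGeodetic : V H → ∀ S → IsStrongGeodeticSet P S → IsGeodeticSet G (image πG S)
  projectStrongGeodetic h₀ S (paths , covered) w with covered (combine w h₀)
  ... | inj₁ wh₀∈S = inj₁ (subst (_∈ image πG S) (πG-combine w h₀) (∈image πG S wh₀∈S))
  ... | inj₂ (x , y , x∈S , y∈S , x<y , onPath)
    with projectGeodesic (paths x y x∈S y∈S x<y)
  ... | R , projectedOn = inj₂ (πG x , πG y , ∈image πG S x∈S , ∈image πG S y∈S , R ,
          subst (λ z → OnGeodesic z R) (πG-combine w h₀) (projectedOn _ onPath))

proposition6p2 : (G H : Graph) → Simple G → Simple H → Connected G → Connected H →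
    GeneralizedGeodetic G →
    ∀ a b → StrongGeodeticNumberIs G a → StrongGeodeticNumberIs (G □ H) b → a ≤ b
proposition6p2 G H _ _ _ (H-nonempty , _)
  (k , (_ , g-minimum) , ((S₀ , S₀-strong , ∣S₀∣≡k) , _))
  a b (_ , sg-minimum) ((S , S-strong , ∣S∣≡b) , _) =
  begin
    a                ≤⟨ sg-minimum S₀ S₀-strong ⟩
    ∣ S₀ ∣           ≡⟨ ∣S₀∣≡k ⟩
    k                ≤⟨ g-minimum (image πG S) (projectStrongGeodetic h₀ S S-strong) ⟩
    ∣ image πG S ∣   ≤⟨ ∣image∣≤ πG S ⟩
    ∣ S ∣            ≡⟨ ∣S∣≡b ⟩
    b                ∎
  where
  open Product G H
  open ≤-Reasoning
  h₀ : V H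
  h₀ = fromℕ< H-nonempty
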